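{- The tuple $\mathcal{M}_s=(\mathbf{PER},D,\mathrm{id}_D,\mathrm{id}_D,(c_i)_{1\leq i\leq n},\mathtt{case},\mathtt{fail})$ is a $\lambda_C$-model.
   Context: Lambda calculus with constructors ($\lambda_C$): terms $t,u::= x \mid tu \mid \lambda x.t \mid \mathtt{c} \mid \{\theta\}\cdot t$, where $\mathtt{c}$ ranges over a finite set of constructors $\{\mathtt{c}_1,\dots,\mathtt{c}_n\}$ and a case-binding $\theta=\{\mathtt{c}_{i_1}\mapsto u_1;\dots;\mathtt{c}_{i_k}\mapsto u_k\}$ is a finite partial function from constructors to terms. Reduction rules: $(\lambda x.t)u\to t[x:=u]$; $\lambda x.tx\to t$ ($x\notin FV(t)$); $\{\theta\}\cdot\mathtt{c}\to t$ if $(\mathtt{c}\mapsto t)\in\theta$; $\{\theta\}\cdot(tu)\to(\{\theta\}\cdot t)u$; $\{\theta\}\cdot\lambda x.t\to\lambda x.\{\theta\}\cdot t$ ($x\notin FV(\theta)$); $\{\theta\}\cdot\{\phi\}\cdot t\to\{\theta\circ\phi\}\cdot t$ where $\theta\circ\{\mathtt{c}_i\mapsto t_i\}=\{\mathtt{c}_i\mapsto\{\theta\}\cdot t_i\}$. $\simeq_{\lambda_C}$ is the reflexive symmetric transitive (and contextual) closure of these rules. A $\lambda_C$-model is $(\mathcal{C},D,\mathtt{app},\mathtt{lam},(c_i)_{i=1}^n,\mathtt{fail},\mathtt{case})$ with $\mathcal{C}$ a Cartesian closed category, $D$ an object, $c_i,\mathtt{fail}:1\to D$ points, $\mathtt{app}:D\to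 D^D$, $\mathtt{lam}:D^D\to D$, $\mathtt{case}:D^n\times D\to D$, such that: (D1) $\mathtt{lam};\mathtt{app}=\mathrm{id}_{D^D}$ and $\mathtt{app};\mathtt{lam}=\mathrm{id}_D$; (D2) for each $i$, $(D^n\cong D^n\times 1);(\mathrm{id}\times c_i);\mathtt{case}=\pi^n_i$; (D3) $(\mathtt{case}\times\mathrm{id});(\mathtt{app}\times\mathrm{id});\mathrm{ev}=\cong;(\mathrm{id}\times(\mathtt{app}\times\mathrm{id}));(\mathrm{id}\times\mathrm{ev});\mathtt{case}$ as maps $(D^n\times D)\times D\to D$; (D4) $(\mathrm{id}\times\mathtt{lam});\mathtt{case}=\widehat{\mathtt{case}};\mathtt{lam}$ where $\widehat{\mathtt{case}}=\Lambda(\cong;(\mathrm{id}_{D^n}\times\mathrm{ev});\mathtt{case}):D^n\times D^D\to D^D$; (D5) $(\mathtt{comp}\times\mathrm{id});\mathtt{case}=\cong;(\mathrm{id}\times\mathtt{case});\mathtt{case}$ as maps $(D^n\times D^n)\times D\to D$, where $\mathtt{comp}=\langle(\mathrm{id}_{D^n}\times\pi^n_i);\mathtt{case}\rangle_{i=1}^n$; (D6) $(\mathrm{id}_{D^n}\times\mathtt{fail});\mathtt{case}=\pi_2;\mathtt{fail}:D^n\times 1\to D$. A PER is a symmetric transitive relation $R$ on the set $\Lambda_C$ of all $\lambda_C$-terms, compatible with $\simeq_{\lambda_C}$ ($t\,R\,t'$ and $t_0\simeq_{\lambda_C}t'$ imply $t\,R\,t_0$). Using Church tuples $\langle x_1,\dots,x_k\rangle=\lambda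 f.f x_1\cdots x_k$, $\pi^k_i=\lambda p.p(\lambda x_1\dots x_k.x_i)$, define $t\,(A\to B)\,t'$ iff $u\,A\,u'$ implies $tu\,B\,t'u'$, and $t\,(A_1\times\dots\times A_k)\,u$ iff $\pi^k_i t\,A_i\,\pi^k_i u$ for all $i$. The category $\mathbf{PER}$ has these PERs as objects and as morphisms $A\to B$ the equivalence classes $[t]$ of terms related to themselves by $A\to B$; identity $[\lambda x.x]$, composition $[t];[t']=[\lambda z.t'(tz)]$, product $A\times B$ with projections $[\pi_1],[\pi_2]$ and pairing $[\lambda x.\langle tx,t'x\rangle]$, terminal object $\Lambda_C\times\Lambda_C$, exponential $B^A=A\to B$, $\mathrm{ev}=[\lambda x.(\pi_1x)(\pi_2x)]$, currying $\Lambda([t])=[\lambda x.\lambda y.t\langle x,y\rangle]$; it is Cartesian closed. In $\mathcal{M}_s$: $D$ is the relation $\simeq_{\lambda_C}$ (which satisfies $D=D^D$); $c_i=[\lambda x.\mathtt{c}_i]:1\to D$; $\mathtt{case}=[\lambda x.\{(\mathtt{c}_i\mapsto\pi^n_i(\pi_1x))_{1\leq i\leq n}\}\cdot\pi_2x]:D^n\times D\to D$; $\mathtt{fail}=[\lambda x.\{\,\}\cdot\mathtt{c}_1]:1\to D$. -}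

module Defs where

open import Data.Nat using (ℕ; zero; suc; _∸_)
open import Data.Fin using (Fin; zero; suc; toℕ)
open import Data.Maybe using (Maybe; just; nothing)
open import Data.Unit using (⊤)
open import Data.Product using (_×_)
open import Relation.Binary.PropositionalEquality using (_≡_)

-- The λC-calculus over the constructor set {c_1,…,c_n} (represented by
-- Fin n; c_i is `con i` with i 0-based).  Terms use (unscoped) de Bruijn
-- indices, so Λ_C (all terms, open ones included) is the type `Term`.

module LC (n : ℕ) where

  data Term : Set where
    var  : ℕ → Term
    app  : Term → Term → Term
    lam  : Term → Term
    con  : Fin n → Term
    case : (Fin n → Maybe Term) → Term → Term

  CaseBinding : Set
  CaseBinding = Fin n → Maybe Term

  ext : (ℕ → ℕ) → ℕ → ℕ
  ext ρ zero    = zero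
  ext ρ (suc x) = suc (ρ x)

  mutual
    rename : (ℕ → ℕ) → Term → Term
    rename ρ (var x)    = var (ρ x)
    rename ρ (app t u)  = app (rename ρ t) (rename ρ u)
    rename ρ (lam t)    = lam (rename (ext ρ) t)
    rename ρ (con c)    = con c
    rename ρ (case θ t) = case (λ c → renameM ρ (θ c)) (rename ρ t)

    renameM : (ℕ → ℕ) → Maybe Term → Maybe Term
    renameM ρ nothing  = nothing
    renameM ρ (just t) = just (rename ρ t)

  ↑ : Term → Term
  ↑ = rename suc

  ↑θ : CaseBinding → CaseBinding
  ↑θ θ c = renameM suc (θ c)

  exts : (ℕ → Term) → ℕ → Term
  exts σ zero    = var zero
  exts σ (suc x) = ↑ (σ x)

  mutual
    subst : (ℕ → Term) → Term → Term
    subst σ (var x)    = σ x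
    subst σ (app t u)  = app (subst σ t) (subst σ u)
    subst σ (lam t)    = lam (subst (exts σ) t)
    subst σ (con c)    = con c
    subst σ (case θ t) = case (λ c → substM σ (θ c)) (subst σ t)

    substM : (ℕ → Term) → Maybe Term → Maybe Term
    substM σ nothing  = nothing
    substM σ (just t) = just (subst σ t)

  _[0:=_] : Term → Term → Term
  t [0:= u ] = subst σ t
    where
    σ : ℕ → Term
    σ zero    = u
    σ (suc x) = var x

  _∘θ_ : CaseBinding → CaseBinding → CaseBinding
  (θ ∘θ φ) c with φ c
  ... | nothing = nothing
  ... | just t  = just (case θ t)

  data _⟶_ : Term → Term → Set where
    β        : ∀ t u → app (lam t) u ⟶ (t [0:= u ])
    η        : ∀ t → lam (app (↑ t) (var 0)) ⟶ t          -- x ∉ FV(t)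
    case-con : ∀ θ c t → θ c ≡ just t → case θ (con c) ⟶ t
    case-app : ∀ θ t u → case θ (app t u) ⟶ app (case θ t) u
    case-lam : ∀ θ t → case θ (lam t) ⟶ lam (case (↑θ θ) t) -- x ∉ FV(θ)
    case-case : ∀ θ φ t → case θ (case φ t) ⟶ case (θ ∘θ φ) t

  mutual
    data _≃_ : Term → Term → Set where
      step   : ∀ {t u} → t ⟶ u → t ≃ u
      refl≃  : ∀ {t} → t ≃ t
      sym≃   : ∀ {t u} → t ≃ u → u ≃ t
      trans≃ : ∀ {t u v} → t ≃ u → u ≃ v → t ≃ v
      app≃   : ∀ {t t′ u u′} → t ≃ t′ → u ≃ u′ → app t u ≃ app t′ u′
      lam≃   : ∀ {t t′} → t ≃ t′ → lam t ≃ lam t′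
      case≃  : ∀ {θ θ′ t t′} → (∀ c → θ c ≃M θ′ c) → t ≃ t′ →
               case θ t ≃ case θ′ t′

    data _≃M_ : Maybe Term → Maybe Term → Set where
      nothing≃ : nothing ≃M nothing
      just≃    : ∀ {t u} → t ≃ u → just t ≃M just u

  apps : Term → (k : ℕ) → (Fin k → Term) → Term
  apps t zero    us = t
  apps t (suc k) us = apps (app t (us zero)) k (λ i → us (suc i))

  lams : ℕ → Term → Term
  lams zero    t = t
  lams (suc k) t = lams k (lam t)

  tuple : (k : ℕ) → (Fin k → Term) → Term
  tuple k ts = lam (apps (var 0) k (λ i → ↑ (ts i)))

  -- π^k_i = λ p . p (λ x_1 … x_k . x_i)      (i 0-based here)
  proj : (k : ℕ) → Fin k → Term
  proj k i = lam (app (var 0) (lams k (var (k ∸ suc (toℕ i)))))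

  ⟨_,_⟩ : Term → Term → Term
  ⟨ a , b ⟩ = tuple 2 (λ { zero → a ; (suc zero) → b })

  π₁ π₂ : Term
  π₁ = proj 2 zero
  π₂ = proj 2 (suc zero)

  Rel : Set₁
  Rel = Term → Term → Set

  record IsPER (R : Rel) : Set where
    field
      symm  : ∀ {t u} → R t u → R u t
      trans : ∀ {t u v} → R t u → R u v → R t v
      compat : ∀ {t t′ t₀} → R t t′ → t₀ ≃ t′ → R t t₀

  _⇒_ : Rel → Rel → Rel
  (A ⇒ B) t t′ = ∀ {u u′} → A u u′ → B (app t u) (app t′ u′)

  Π : (k : ℕ) → (Fin k → Rel) → Rel
  Π k A t u = ∀ i → A i (app (proj k i) t) (app (proj k i) u)

  _⊗_ : Rel → Rel → Rel
  A ⊗ B = Π 2 (λ { zero → A ; (suc zero) → B })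

  𝟙 : Rel
  𝟙 _ _ = ⊤

  _^_ : Rel → ℕ → Rel
  D ^ k = Π k (λ _ → D)

  Mor : Rel → Rel → Term → Set
  Mor A B t = (A ⇒ B) t t

  EqMor : Rel → Rel → Term → Term → Set
  EqMor A B t t′ = (A ⇒ B) t t′

  idT : Term
  idT = lam (var 0)

  _⨾_ : Term → Term → Term
  t ⨾ t′ = lam (app (↑ t′) (app (↑ t) (var 0)))

  pairT : Term → Term → Term
  pairT t t′ = lam ⟨ app (↑ t) (var 0) , app (↑ t′) (var 0) ⟩

  tupleT : (k : ℕ) → (Fin k → Term) → Term
  tupleT k ts = lam (tuple k (λ i → app (↑ (ts i)) (var 0)))

  _⊗T_ : Term → Term → Term
  f ⊗T g = pairT (π₁ ⨾ f) (π₂ ⨾ g)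

  !T : Term
  !T = idT

  evT : Term
  evT = lam (app (app π₁ (var 0)) (app π₂ (var 0)))

  curryT : Term → Term
  curryT t = lam (lam (app (↑ (↑ t)) ⟨ var 1 , var 0 ⟩))

  unitorT : Term
  unitorT = pairT idT !T

  assocT : Term
  assocT = pairT (π₁ ⨾ π₁) (pairT (π₁ ⨾ π₂) π₂)

  record IsλCModel (D : Rel) (appT lamT : Term) (cs : Fin n → Term)
                   (failT caseT : Term) : Set where
    field
      D-PER    : IsPER D
      app-mor  : Mor D (D ⇒ D) appT
      lam-mor  : Mor (D ⇒ D) D lamT
      c-mor    : ∀ i → Mor 𝟙 D (cs i)
      fail-mor : Mor 𝟙 D failT
      case-mor : Mor ((D ^ n) ⊗ D) D caseT
      D1a : EqMor (D ⇒ D) (D ⇒ D) (lamT ⨾ appT) idT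
      D1b : EqMor D D (appT ⨾ lamT) idT
      D2 : ∀ i → EqMor (D ^ n) D
                   ((unitorT ⨾ (idT ⊗T cs i)) ⨾ caseT) (proj n i)
      D3 : EqMor (((D ^ n) ⊗ D) ⊗ D) D
             (((caseT ⊗T idT) ⨾ (appT ⊗T idT)) ⨾ evT)
             (((assocT ⨾ (idT ⊗T (appT ⊗T idT))) ⨾ (idT ⊗T evT)) ⨾ caseT)
      D4 : EqMor ((D ^ n) ⊗ (D ⇒ D)) D
             ((idT ⊗T lamT) ⨾ caseT)
             (curryT ((assocT ⨾ (idT ⊗T evT)) ⨾ caseT) ⨾ lamT)
      D5 : EqMor (((D ^ n) ⊗ (D ^ n)) ⊗ D) D
             ((tupleT n (λ i → (idT ⊗T proj n i) ⨾ caseT) ⊗T idT) ⨾ caseT)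
             ((assocT ⨾ (idT ⊗T caseT)) ⨾ caseT)
      D6 : EqMor ((D ^ n) ⊗ 𝟙) D ((idT ⊗T failT) ⨾ caseT) (π₂ ⨾ failT)

  Ds : Rel
  Ds = _≃_

  cT : Fin n → Term
  cT i = lam (con i)

  caseMs : Term
  caseMs = lam (case (λ i → just (app (proj n i) (app π₁ (var 0))))
                     (app π₂ (var 0)))

module _ (m : ℕ) where
  open LC (suc m)
  -- fail = [λx.{ }·c_1]   (needs at least one constructor)
  failMs : Term
  failMs = lam (case (λ _ → nothing) (con zero))

-- D is ≃ itself, and D = D ⇒ D because ≃ is closed under substitution and η:
-- from u x ≃ u′ x for a fresh variable x we get u ≃ λx.u x ≃ λx.u′ x ≃ u′.
-- Every equation (D1)–(D6) is then checked pointwise: applied to related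
-- arguments, both sides β-reduce through the Church-tuple combinators to a
-- common form, up to one of the rules case-con, case-app, case-lam, case-case
-- (the very rule that the equation models).
module Submission where

open import Defs
open import Data.Nat using (ℕ; zero; suc; _+_; _∸_; _<_; _≤_; s≤s; z≤n; _⊔_; _≟_)
open import Data.Nat.Properties
  using (+-suc; +-identityʳ; m∸n≤m; m≤m+n; m≤m⊔n; m≤n⊔m; n≤1+n; <-irrefl; ≤-refl; ≤-trans)
open import Data.Fin using (Fin; toℕ; zero; suc)
open import Data.Maybe using (Maybe; just; nothing)
open import Data.Product using (∃; _,_)
open import Data.Empty using (⊥-elim)
open import Relation.Nullary using (yes; no)
open import Relation.Binary.PropositionalEquality using (_≡_; refl; cong; sym)

uniform-bound : ∀ k (P : Fin k → ℕ → Set) → (∀ c {a b} → P c a → a ≤ b → P c b) →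
                (∀ c → ∃ (P c)) → ∃ λ N → ∀ c → P c N
uniform-bound zero    P mono bound = 0 , λ ()
uniform-bound (suc k) P mono bound
  with bound zero | uniform-bound k (λ c → P (suc c)) (λ c → mono (suc c)) (λ c → bound (suc c))
... | a , pa | b , pb = a ⊔ b , λ where
  zero    → mono zero pa (m≤m⊔n a b)
  (suc c) → mono (suc c) (pb c) (m≤n⊔m a b)

module Syntax (n : ℕ) where
  open LC n

  infixr 4 _⊙_
  _⊙_ : ∀ {a b c} → a ≃ b → b ≃ c → a ≃ c
  _⊙_ = trans≃

  -- Syntactic identity up to pointwise equality of case-bindings: these are
  -- functions, so _≡_ would need function extensionality.
  mutual
    data _≈_ : Term → Term → Set where
      var≈  : ∀ x → var x ≈ var x
      app≈  : ∀ {t t′ u u′} → t ≈ t′ → u ≈ u′ → app t u ≈ app t′ u′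
      lam≈  : ∀ {t t′} → t ≈ t′ → lam t ≈ lam t′
      con≈  : ∀ c → con c ≈ con c
      case≈ : ∀ {θ θ′ t t′} → (∀ c → θ c ≈M θ′ c) → t ≈ t′ → case θ t ≈ case θ′ t′

    data _≈M_ : Maybe Term → Maybe Term → Set where
      nothing≈ : nothing ≈M nothing
      just≈    : ∀ {t u} → t ≈ u → just t ≈M just u

  mutual
    ≈-refl : ∀ t → t ≈ t
    ≈-refl (var x)    = var≈ x
    ≈-refl (app t u)  = app≈ (≈-refl t) (≈-refl u)
    ≈-refl (lam t)    = lam≈ (≈-refl t)
    ≈-refl (con c)    = con≈ c
    ≈-refl (case θ t) = case≈ (λ c → ≈M-refl (θ c)) (≈-refl t)

    ≈M-refl : ∀ t → t ≈M t
    ≈M-refl nothing  = nothing≈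
    ≈M-refl (just t) = just≈ (≈-refl t)

  mutual
    ≈-sym : ∀ {t u} → t ≈ u → u ≈ t
    ≈-sym (var≈ x)    = var≈ x
    ≈-sym (app≈ p q)  = app≈ (≈-sym p) (≈-sym q)
    ≈-sym (lam≈ p)    = lam≈ (≈-sym p)
    ≈-sym (con≈ c)    = con≈ c
    ≈-sym (case≈ f p) = case≈ (λ c → ≈M-sym (f c)) (≈-sym p)

    ≈M-sym : ∀ {t u} → t ≈M u → u ≈M t
    ≈M-sym nothing≈  = nothing≈
    ≈M-sym (just≈ p) = just≈ (≈-sym p)

  mutual
    ≈-trans : ∀ {t u v} → t ≈ u → u ≈ v → t ≈ v
    ≈-trans (var≈ x)    (var≈ _)      = var≈ x
    ≈-trans (app≈ p q)  (app≈ p′ q′)  = app≈ (≈-trans p p′) (≈-trans q q′)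
    ≈-trans (lam≈ p)    (lam≈ p′)     = lam≈ (≈-trans p p′)
    ≈-trans (con≈ c)    (con≈ _)      = con≈ c
    ≈-trans (case≈ f p) (case≈ f′ p′) = case≈ (λ c → ≈M-trans (f c) (f′ c)) (≈-trans p p′)

    ≈M-trans : ∀ {t u v} → t ≈M u → u ≈M v → t ≈M v
    ≈M-trans nothing≈  nothing≈  = nothing≈
    ≈M-trans (just≈ p) (just≈ q) = just≈ (≈-trans p q)

  mutual
    ≈⇒≃ : ∀ {t u} → t ≈ u → t ≃ u
    ≈⇒≃ (var≈ x)    = refl≃
    ≈⇒≃ (app≈ p q)  = app≃ (≈⇒≃ p) (≈⇒≃ q)
    ≈⇒≃ (lam≈ p)    = lam≃ (≈⇒≃ p)
    ≈⇒≃ (con≈ c)    = refl≃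
    ≈⇒≃ (case≈ f p) = case≃ (λ c → ≈M⇒≃M (f c)) (≈⇒≃ p)

    ≈M⇒≃M : ∀ {t u} → t ≈M u → t ≃M u
    ≈M⇒≃M nothing≈  = nothing≃
    ≈M⇒≃M (just≈ p) = just≃ (≈⇒≃ p)

  ≡⇒≈ : ∀ {t u} → t ≡ u → t ≈ u
  ≡⇒≈ {t} refl = ≈-refl t

  mutual
    rename-resp-≈ : ∀ ρ {t t′} → t ≈ t′ → rename ρ t ≈ rename ρ t′
    rename-resp-≈ ρ (var≈ x)    = var≈ _
    rename-resp-≈ ρ (app≈ p q)  = app≈ (rename-resp-≈ ρ p) (rename-resp-≈ ρ q)
    rename-resp-≈ ρ (lam≈ p)    = lam≈ (rename-resp-≈ (ext ρ) p)
    rename-resp-≈ ρ (con≈ c)    = con≈ c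
    rename-resp-≈ ρ (case≈ f p) = case≈ (λ c → renameM-resp-≈M ρ (f c)) (rename-resp-≈ ρ p)

    renameM-resp-≈M : ∀ ρ {t t′} → t ≈M t′ → renameM ρ t ≈M renameM ρ t′
    renameM-resp-≈M ρ nothing≈  = nothing≈
    renameM-resp-≈M ρ (just≈ p) = just≈ (rename-resp-≈ ρ p)

  ext-cong : ∀ {ρ ρ′} → (∀ x → ρ x ≡ ρ′ x) → ∀ x → ext ρ x ≡ ext ρ′ x
  ext-cong h zero    = refl
  ext-cong h (suc x) = cong suc (h x)

  mutual
    rename-cong : ∀ {ρ ρ′} → (∀ x → ρ x ≡ ρ′ x) → ∀ t → rename ρ t ≈ rename ρ′ t
    rename-cong h (var x)    = ≡⇒≈ (cong var (h x))
    rename-cong h (app t u)  = app≈ (rename-cong h t) (rename-cong h u)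
    rename-cong h (lam t)    = lam≈ (rename-cong (ext-cong h) t)
    rename-cong h (con c)    = con≈ c
    rename-cong h (case θ t) = case≈ (λ c → renameM-cong h (θ c)) (rename-cong h t)

    renameM-cong : ∀ {ρ ρ′} → (∀ x → ρ x ≡ ρ′ x) → ∀ t → renameM ρ t ≈M renameM ρ′ t
    renameM-cong h nothing  = nothing≈
    renameM-cong h (just t) = just≈ (rename-cong h t)

  mutual
    subst-resp-≈ : ∀ σ {t t′} → t ≈ t′ → subst σ t ≈ subst σ t′
    subst-resp-≈ σ (var≈ x)    = ≈-refl _
    subst-resp-≈ σ (app≈ p q)  = app≈ (subst-resp-≈ σ p) (subst-resp-≈ σ q)
    subst-resp-≈ σ (lam≈ p)    = lam≈ (subst-resp-≈ (exts σ) p)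
    subst-resp-≈ σ (con≈ c)    = con≈ c
    subst-resp-≈ σ (case≈ f p) = case≈ (λ c → substM-resp-≈M σ (f c)) (subst-resp-≈ σ p)

    substM-resp-≈M : ∀ σ {t t′} → t ≈M t′ → substM σ t ≈M substM σ t′
    substM-resp-≈M σ nothing≈  = nothing≈
    substM-resp-≈M σ (just≈ p) = just≈ (subst-resp-≈ σ p)

  exts-cong : ∀ {σ τ} → (∀ x → σ x ≈ τ x) → ∀ x → exts σ x ≈ exts τ x
  exts-cong h zero    = var≈ 0
  exts-cong h (suc x) = rename-resp-≈ suc (h x)

  mutual
    subst-cong : ∀ {σ τ} → (∀ x → σ x ≈ τ x) → ∀ t → subst σ t ≈ subst τ t
    subst-cong h (var x)    = h x
    subst-cong h (app t u)  = app≈ (subst-cong h t) (subst-cong h u)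
    subst-cong h (lam t)    = lam≈ (subst-cong (exts-cong h) t)
    subst-cong h (con c)    = con≈ c
    subst-cong h (case θ t) = case≈ (λ c → substM-cong h (θ c)) (subst-cong h t)

    substM-cong : ∀ {σ τ} → (∀ x → σ x ≈ τ x) → ∀ t → substM σ t ≈M substM τ t
    substM-cong h nothing  = nothing≈
    substM-cong h (just t) = just≈ (subst-cong h t)

  mutual
    rename-rename : ∀ ρ ρ′ t → rename ρ (rename ρ′ t) ≈ rename (λ x → ρ (ρ′ x)) t
    rename-rename ρ ρ′ (var x)    = var≈ _
    rename-rename ρ ρ′ (app t u)  = app≈ (rename-rename ρ ρ′ t) (rename-rename ρ ρ′ u)
    rename-rename ρ ρ′ (lam t)    =
      lam≈ (≈-trans (rename-rename (ext ρ) (ext ρ′) t)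
                    (rename-cong (λ { zero → refl ; (suc x) → refl }) t))
    rename-rename ρ ρ′ (con c)    = con≈ c
    rename-rename ρ ρ′ (case θ t) =
      case≈ (λ c → renameM-renameM ρ ρ′ (θ c)) (rename-rename ρ ρ′ t)

    renameM-renameM : ∀ ρ ρ′ t → renameM ρ (renameM ρ′ t) ≈M renameM (λ x → ρ (ρ′ x)) t
    renameM-renameM ρ ρ′ nothing  = nothing≈
    renameM-renameM ρ ρ′ (just t) = just≈ (rename-rename ρ ρ′ t)

  mutual
    subst-rename : ∀ σ ρ t → subst σ (rename ρ t) ≈ subst (λ x → σ (ρ x)) t
    subst-rename σ ρ (var x)    = ≈-refl _
    subst-rename σ ρ (app t u)  = app≈ (subst-rename σ ρ t) (subst-rename σ ρ u)
    subst-rename σ ρ (lam t)    =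
      lam≈ (≈-trans (subst-rename (exts σ) (ext ρ) t)
                    (subst-cong (λ { zero → var≈ 0 ; (suc x) → ≈-refl _ }) t))
    subst-rename σ ρ (con c)    = con≈ c
    subst-rename σ ρ (case θ t) = case≈ (λ c → substM-renameM σ ρ (θ c)) (subst-rename σ ρ t)

    substM-renameM : ∀ σ ρ t → substM σ (renameM ρ t) ≈M substM (λ x → σ (ρ x)) t
    substM-renameM σ ρ nothing  = nothing≈
    substM-renameM σ ρ (just t) = just≈ (subst-rename σ ρ t)

  mutual
    rename-subst : ∀ ρ σ t → rename ρ (subst σ t) ≈ subst (λ x → rename ρ (σ x)) t
    rename-subst ρ σ (var x)    = ≈-refl _
    rename-subst ρ σ (app t u)  = app≈ (rename-subst ρ σ t) (rename-subst ρ σ u)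
    rename-subst ρ σ (lam t)    =
      lam≈ (≈-trans (rename-subst (ext ρ) (exts σ) t) (subst-cong commute t))
      where
      commute : ∀ x → rename (ext ρ) (exts σ x) ≈ exts (λ y → rename ρ (σ y)) x
      commute zero    = var≈ 0
      commute (suc x) = ≈-trans (rename-rename (ext ρ) suc (σ x)) (≈-sym (rename-rename suc ρ (σ x)))
    rename-subst ρ σ (con c)    = con≈ c
    rename-subst ρ σ (case θ t) = case≈ (λ c → renameM-substM ρ σ (θ c)) (rename-subst ρ σ t)

    renameM-substM : ∀ ρ σ t → renameM ρ (substM σ t) ≈M substM (λ x → rename ρ (σ x)) t
    renameM-substM ρ σ nothing  = nothing≈
    renameM-substM ρ σ (just t) = just≈ (rename-subst ρ σ t)

  mutual
    subst-subst : ∀ σ τ t → subst σ (subst τ t) ≈ subst (λ x → subst σ (τ x)) t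
    subst-subst σ τ (var x)    = ≈-refl _
    subst-subst σ τ (app t u)  = app≈ (subst-subst σ τ t) (subst-subst σ τ u)
    subst-subst σ τ (lam t)    =
      lam≈ (≈-trans (subst-subst (exts σ) (exts τ) t) (subst-cong commute t))
      where
      commute : ∀ x → subst (exts σ) (exts τ x) ≈ exts (λ y → subst σ (τ y)) x
      commute zero    = var≈ 0
      commute (suc x) = ≈-trans (subst-rename (exts σ) suc (τ x)) (≈-sym (rename-subst suc σ (τ x)))
    subst-subst σ τ (con c)    = con≈ c
    subst-subst σ τ (case θ t) = case≈ (λ c → substM-substM σ τ (θ c)) (subst-subst σ τ t)

    substM-substM : ∀ σ τ t → substM σ (substM τ t) ≈M substM (λ x → subst σ (τ x)) t
    substM-substM σ τ nothing  = nothing≈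
    substM-substM σ τ (just t) = just≈ (subst-subst σ τ t)

  mutual
    subst-var : ∀ t → subst var t ≈ t
    subst-var (var x)    = var≈ x
    subst-var (app t u)  = app≈ (subst-var t) (subst-var u)
    subst-var (lam t)    =
      lam≈ (≈-trans (subst-cong (λ { zero → var≈ 0 ; (suc x) → var≈ (suc x) }) t) (subst-var t))
    subst-var (con c)    = con≈ c
    subst-var (case θ t) = case≈ (λ c → substM-var (θ c)) (subst-var t)

    substM-var : ∀ t → substM var t ≈M t
    substM-var nothing  = nothing≈
    substM-var (just t) = just≈ (subst-var t)

  mutual
    rename-as-subst : ∀ ρ t → rename ρ t ≈ subst (λ x → var (ρ x)) t
    rename-as-subst ρ (var x)    = var≈ _
    rename-as-subst ρ (app t u)  = app≈ (rename-as-subst ρ t) (rename-as-subst ρ u)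
    rename-as-subst ρ (lam t)    =
      lam≈ (≈-trans (rename-as-subst (ext ρ) t)
                    (subst-cong (λ { zero → var≈ 0 ; (suc x) → var≈ _ }) t))
    rename-as-subst ρ (con c)    = con≈ c
    rename-as-subst ρ (case θ t) = case≈ (λ c → renameM-as-substM ρ (θ c)) (rename-as-subst ρ t)

    renameM-as-substM : ∀ ρ t → renameM ρ t ≈M substM (λ x → var (ρ x)) t
    renameM-as-substM ρ nothing  = nothing≈
    renameM-as-substM ρ (just t) = just≈ (rename-as-subst ρ t)

  single : Term → ℕ → Term
  single u zero    = u
  single u (suc x) = var x

  subst-single-↑ : ∀ u t → subst (single u) (↑ t) ≈ t
  subst-single-↑ u t = ≈-trans (subst-rename (single u) suc t) (subst-var t)

  subst-exts-↑ : ∀ σ t → subst (exts σ) (↑ t) ≈ ↑ (subst σ t)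
  subst-exts-↑ σ t = ≈-trans (subst-rename (exts σ) suc t) (≈-sym (rename-subst suc σ t))

  β≃ : ∀ t u → app (lam t) u ≃ subst (single u) t
  β≃ t u = step (β t u) ⊙ ≈⇒≃ (subst-cong (λ { zero → ≈-refl u ; (suc x) → var≈ x }) t)

  β-subst : ∀ σ t u → subst (single (subst σ u)) (subst (exts σ) t) ≈ subst σ (subst (single u) t)
  β-subst σ t u =
    ≈-trans (subst-subst (single (subst σ u)) (exts σ) t)
            (≈-trans (subst-cong (λ { zero → ≈-refl _ ; (suc x) → subst-single-↑ (subst σ u) (σ x) }) t)
                     (≈-sym (subst-subst σ (single u) t)))

  subst-⟶ : ∀ σ {t u} → t ⟶ u → subst σ t ≃ subst σ u
  subst-⟶ σ (β t u) =
    β≃ (subst (exts σ) t) (subst σ u)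
    ⊙ ≈⇒≃ (≈-trans (β-subst σ t u)
                   (subst-resp-≈ σ (subst-cong (λ { zero → ≈-refl u ; (suc x) → var≈ x }) t)))
  subst-⟶ σ (η t) = lam≃ (app≃ (≈⇒≃ (subst-exts-↑ σ t)) refl≃) ⊙ step (η (subst σ t))
  subst-⟶ σ (case-con θ c t e) = step (case-con _ c _ (cong (substM σ) e))
  subst-⟶ σ (case-app θ t u) = step (case-app _ _ _)
  subst-⟶ σ (case-lam θ t) =
    step (case-lam _ _) ⊙ lam≃ (case≃ (λ c → ≈M⇒≃M (↑θ-substM (θ c))) refl≃)
    where
    ↑θ-substM : ∀ t → renameM suc (substM σ t) ≈M substM (exts σ) (renameM suc t)
    ↑θ-substM nothing  = nothing≈
    ↑θ-substM (just t) = just≈ (≈-sym (subst-exts-↑ σ t))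
  subst-⟶ σ (case-case θ φ t) = step (case-case _ _ _) ⊙ case≃ (λ c → ≈M⇒≃M (∘θ-substM c)) refl≃
    where
    ∘θ-substM : ∀ c → ((λ c → substM σ (θ c)) ∘θ (λ c → substM σ (φ c))) c ≈M substM σ ((θ ∘θ φ) c)
    ∘θ-substM c with φ c
    ... | nothing = nothing≈
    ... | just s  = just≈ (≈-refl _)

  mutual
    subst-≃ : ∀ σ {t u} → t ≃ u → subst σ t ≃ subst σ u
    subst-≃ σ (step s)     = subst-⟶ σ s
    subst-≃ σ refl≃        = refl≃
    subst-≃ σ (sym≃ p)     = sym≃ (subst-≃ σ p)
    subst-≃ σ (trans≃ p q) = subst-≃ σ p ⊙ subst-≃ σ q
    subst-≃ σ (app≃ p q)   = app≃ (subst-≃ σ p) (subst-≃ σ q)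
    subst-≃ σ (lam≃ p)     = lam≃ (subst-≃ (exts σ) p)
    subst-≃ σ (case≃ f p)  = case≃ (λ c → substM-≃M σ (f c)) (subst-≃ σ p)

    substM-≃M : ∀ σ {t u} → t ≃M u → substM σ t ≃M substM σ u
    substM-≃M σ nothing≃  = nothing≃
    substM-≃M σ (just≃ p) = just≃ (subst-≃ σ p)

  mutual
    data Scoped : ℕ → Term → Set where
      s-var  : ∀ {N x} → x < N → Scoped N (var x)
      s-app  : ∀ {N t u} → Scoped N t → Scoped N u → Scoped N (app t u)
      s-lam  : ∀ {N t} → Scoped (suc N) t → Scoped N (lam t)
      s-con  : ∀ {N c} → Scoped N (con c)
      s-case : ∀ {N θ t} → (∀ c → ScopedM N (θ c)) → Scoped N t → Scoped N (case θ t)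

    data ScopedM : ℕ → Maybe Term → Set where
      s-nothing : ∀ {N} → ScopedM N nothing
      s-just    : ∀ {N t} → Scoped N t → ScopedM N (just t)

  Closed : Term → Set
  Closed = Scoped 0

  mutual
    scoped-weaken : ∀ {N M t} → Scoped N t → N ≤ M → Scoped M t
    scoped-weaken (s-var p)    le = s-var (≤-trans p le)
    scoped-weaken (s-app p q)  le = s-app (scoped-weaken p le) (scoped-weaken q le)
    scoped-weaken (s-lam p)    le = s-lam (scoped-weaken p (s≤s le))
    scoped-weaken s-con        le = s-con
    scoped-weaken (s-case f p) le = s-case (λ c → scopedM-weaken (f c) le) (scoped-weaken p le)

    scopedM-weaken : ∀ {N M t} → ScopedM N t → N ≤ M → ScopedM M t
    scopedM-weaken s-nothing  le = s-nothing
    scopedM-weaken (s-just p) le = s-just (scoped-weaken p le)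

  mutual
    ∃-scope : ∀ t → ∃ λ N → Scoped N t
    ∃-scope (var x) = suc x , s-var ≤-refl
    ∃-scope (app t u) with ∃-scope t | ∃-scope u
    ... | a , p | b , q = a ⊔ b , s-app (scoped-weaken p (m≤m⊔n a b)) (scoped-weaken q (m≤n⊔m a b))
    ∃-scope (lam t) with ∃-scope t
    ... | a , p = a , s-lam (scoped-weaken p (n≤1+n a))
    ∃-scope (con c) = 0 , s-con
    ∃-scope (case θ t)
      with uniform-bound n (λ c N → ScopedM N (θ c)) (λ c → scopedM-weaken) (λ c → ∃-scopeM (θ c))
         | ∃-scope t
    ... | a , p | b , q =
      a ⊔ b , s-case (λ c → scopedM-weaken (p c) (m≤m⊔n a b)) (scoped-weaken q (m≤n⊔m a b))

    ∃-scopeM : ∀ t → ∃ λ N → ScopedM N t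
    ∃-scopeM nothing  = 0 , s-nothing
    ∃-scopeM (just t) with ∃-scope t
    ... | a , p = a , s-just p

  mutual
    rename-scoped : ∀ {N M ρ t} → (∀ {x} → x < N → ρ x < M) → Scoped N t → Scoped M (rename ρ t)
    rename-scoped h (s-var p)    = s-var (h p)
    rename-scoped h (s-app p q)  = s-app (rename-scoped h p) (rename-scoped h q)
    rename-scoped h (s-lam p)    =
      s-lam (rename-scoped (λ { {zero} _ → s≤s z≤n ; {suc x} (s≤s q) → s≤s (h q) }) p)
    rename-scoped h s-con        = s-con
    rename-scoped h (s-case f p) = s-case (λ c → renameM-scopedM h (f c)) (rename-scoped h p)

    renameM-scopedM : ∀ {N M ρ t} → (∀ {x} → x < N → ρ x < M) → ScopedM N t →
                      ScopedM M (renameM ρ t)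
    renameM-scopedM h s-nothing  = s-nothing
    renameM-scopedM h (s-just p) = s-just (rename-scoped h p)

  ↑-scoped : ∀ {N t} → Scoped N t → Scoped (suc N) (↑ t)
  ↑-scoped = rename-scoped s≤s

  mutual
    subst-cong-scoped : ∀ {N t σ τ} → Scoped N t → (∀ {x} → x < N → σ x ≈ τ x) →
                        subst σ t ≈ subst τ t
    subst-cong-scoped (s-var p)    h = h p
    subst-cong-scoped (s-app p q)  h = app≈ (subst-cong-scoped p h) (subst-cong-scoped q h)
    subst-cong-scoped (s-lam p)    h =
      lam≈ (subst-cong-scoped p (λ { {zero} _ → var≈ 0 ; {suc x} (s≤s q) → rename-resp-≈ suc (h q) }))
    subst-cong-scoped s-con        h = con≈ _
    subst-cong-scoped (s-case f p) h = case≈ (λ c → substM-cong-scopedM (f c) h) (subst-cong-scoped p h)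

    substM-cong-scopedM : ∀ {N t σ τ} → ScopedM N t → (∀ {x} → x < N → σ x ≈ τ x) →
                          substM σ t ≈M substM τ t
    substM-cong-scopedM s-nothing  h = nothing≈
    substM-cong-scopedM (s-just p) h = just≈ (subst-cong-scoped p h)

  closed-subst : ∀ {t} σ → Closed t → subst σ t ≈ t
  closed-subst {t} σ p = ≈-trans (subst-cong-scoped p (λ ())) (subst-var t)

  closed-rename : ∀ {t} ρ → Closed t → rename ρ t ≈ t
  closed-rename {t} ρ p = ≈-trans (rename-as-subst ρ t) (closed-subst _ p)

  fresh : ℕ → ℕ → Term
  fresh N x with x ≟ N
  ... | yes _ = var 0
  ... | no _  = var (suc x)

  fresh-self : ∀ N → fresh N N ≈ var 0
  fresh-self N with N ≟ N
  ... | yes _ = var≈ 0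
  ... | no ne = ⊥-elim (ne refl)

  subst-fresh : ∀ {N t} → Scoped N t → subst (fresh N) t ≈ ↑ t
  subst-fresh {N} {t} p = ≈-trans (subst-cong-scoped p below) (≈-sym (rename-as-subst suc t))
    where
    below : ∀ {x} → x < N → fresh N x ≈ var (suc x)
    below {x} x<N with x ≟ N
    ... | yes refl = ⊥-elim (<-irrefl refl x<N)
    ... | no _     = var≈ _

  -- The variable N, fresh for u and u′, is renamed to the η-bound variable 0.
  ≃-ext : ∀ {u u′} → (_≃_ ⇒ _≃_) u u′ → u ≃ u′
  ≃-ext {u} {u′} h with ∃-scope u | ∃-scope u′
  ... | a , su | b , su′ =
    sym≃ (step (η u))
    ⊙ lam≃ (≈⇒≃ (app≈ (≈-sym (subst-fresh (scoped-weaken su (m≤m⊔n a b)))) (≈-sym (fresh-self N)))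
            ⊙ subst-≃ (fresh N) (h (refl≃ {var N}))
            ⊙ ≈⇒≃ (app≈ (subst-fresh (scoped-weaken su′ (m≤n⊔m a b))) (fresh-self N)))
    ⊙ step (η u′)
    where
    N : ℕ
    N = a ⊔ b

  apps-≃ˡ : ∀ {t t′} k us → t ≃ t′ → apps t k us ≃ apps t′ k us
  apps-≃ˡ zero    us p = p
  apps-≃ˡ (suc k) us p = apps-≃ˡ k (λ i → us (suc i)) (app≃ p refl≃)

  apps-resp-≈ : ∀ {h h′} k {us vs} → h ≈ h′ → (∀ i → us i ≈ vs i) → apps h k us ≈ apps h′ k vs
  apps-resp-≈ zero    p f = p
  apps-resp-≈ (suc k) p f = apps-resp-≈ k (app≈ p (f zero)) (λ i → f (suc i))

  subst-apps : ∀ σ h k us → subst σ (apps h k us) ≈ apps (subst σ h) k (λ i → subst σ (us i))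
  subst-apps σ h zero    us = ≈-refl _
  subst-apps σ h (suc k) us = subst-apps σ (app h (us zero)) k (λ i → us (suc i))

  lams-suc : ∀ k b → lams (suc k) b ≡ lam (lams k b)
  lams-suc zero    b = refl
  lams-suc (suc k) b = lams-suc k (lam b)

  lams-resp-≈ : ∀ k {b b′} → b ≈ b′ → lams k b ≈ lams k b′
  lams-resp-≈ zero    p = p
  lams-resp-≈ (suc k) p = lams-resp-≈ k (lam≈ p)

  lams-scoped : ∀ k {N b} → Scoped (k + N) b → Scoped N (lams k b)
  lams-scoped zero    p = p
  lams-scoped (suc k) p = lams-scoped k (s-lam p)

  extsⁿ : ℕ → (ℕ → Term) → ℕ → Term
  extsⁿ zero    σ = σ
  extsⁿ (suc k) σ = exts (extsⁿ k σ)

  subst-lams : ∀ k σ b → subst σ (lams k b) ≈ lams k (subst (extsⁿ k σ) b)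
  subst-lams zero    σ b = ≈-refl _
  subst-lams (suc k) σ b = subst-lams k σ (lam b)

  extsⁿ-bound : ∀ k σ {x} → x < k → extsⁿ k σ x ≈ var x
  extsⁿ-bound (suc k) σ {zero}  p       = var≈ 0
  extsⁿ-bound (suc k) σ {suc x} (s≤s p) = rename-resp-≈ suc (extsⁿ-bound k σ p)

  extsⁿ-free : ∀ k σ j → extsⁿ k σ (k + j) ≈ rename (k +_) (σ j)
  extsⁿ-free zero    σ j = ≈-sym (≈-trans (rename-as-subst (λ x → x) (σ j)) (subst-var (σ j)))
  extsⁿ-free (suc k) σ j =
    ≈-trans (rename-resp-≈ suc (extsⁿ-free k σ j)) (rename-rename suc (k +_) (σ j))

  arguments : (k : ℕ) → (Fin k → Term) → ℕ → Term
  arguments zero    us = var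
  arguments (suc k) us x = subst (arguments k (λ i → us (suc i))) (extsⁿ k (single (us zero)) x)

  apps-lams : ∀ k b us → apps (lams k b) k us ≃ subst (arguments k us) b
  apps-lams zero    b us = ≈⇒≃ (≈-sym (subst-var b))
  apps-lams (suc k) b us =
    apps-≃ˡ k _ (app≃ (≈⇒≃ (≡⇒≈ (lams-suc k b))) refl≃ ⊙ β≃ (lams k b) (us zero)
                 ⊙ ≈⇒≃ (subst-lams k (single (us zero)) b))
    ⊙ apps-lams k _ (λ i → us (suc i))
    ⊙ ≈⇒≃ (subst-subst (arguments k (λ i → us (suc i))) (extsⁿ k (single (us zero))) b)

  arguments-free : ∀ k us j → arguments k us (k + j) ≈ var j
  arguments-free zero    us j = var≈ j
  arguments-free (suc k) us j rewrite sym (+-suc k j) =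
    ≈-trans (subst-resp-≈ (arguments k (λ i → us (suc i))) (extsⁿ-free k (single (us zero)) (suc j)))
            (arguments-free k (λ i → us (suc i)) j)

  ∸-suc-toℕ< : ∀ k (i : Fin k) → k ∸ suc (toℕ i) < k
  ∸-suc-toℕ< (suc k) i = s≤s (m∸n≤m k (toℕ i))

  arguments-bound : ∀ k us (i : Fin k) → arguments k us (k ∸ suc (toℕ i)) ≈ us i
  arguments-bound (suc k) us zero =
    ≈-trans (subst-resp-≈ rest
              (≈-trans (≡⇒≈ (cong (extsⁿ k (single (us zero))) (sym (+-identityʳ k))))
                       (extsⁿ-free k (single (us zero)) 0)))
      (≈-trans (subst-rename rest (k +_) (us zero))
        (≈-trans (subst-cong (arguments-free k (λ i → us (suc i))) (us zero)) (subst-var (us zero))))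
    where
    rest : ℕ → Term
    rest = arguments k (λ i → us (suc i))
  arguments-bound (suc k) us (suc i) =
    ≈-trans (subst-resp-≈ (arguments k (λ i → us (suc i))) (extsⁿ-bound k _ (∸-suc-toℕ< k i)))
            (arguments-bound k (λ i → us (suc i)) i)

  proj-tuple : ∀ k i ts → app (proj k i) (tuple k ts) ≃ ts i
  proj-tuple k i ts =
    β≃ _ _
    ⊙ app≃ refl≃ (≈⇒≃ (≈-trans (subst-lams k (single (tuple k ts)) (var j))
                               (lams-resp-≈ k (extsⁿ-bound k _ (∸-suc-toℕ< k i)))))
    ⊙ β≃ _ _
    ⊙ ≈⇒≃ (≈-trans (subst-apps _ (var 0) k _) (apps-resp-≈ k (≈-refl _) (λ i → subst-single-↑ _ (ts i))))
    ⊙ apps-lams k (var j) ts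
    ⊙ ≈⇒≃ (arguments-bound k ts i)
    where
    j : ℕ
    j = k ∸ suc (toℕ i)

  proj-closed : ∀ k i → Closed (proj k i)
  proj-closed k i =
    s-lam (s-app (s-var (s≤s z≤n)) (lams-scoped k (s-var (≤-trans (∸-suc-toℕ< k i) (m≤m+n k 1)))))

module Model (n : ℕ) where
  open LC n
  open Syntax n

  Dⁿ : Rel
  Dⁿ = _≃_ ^ n

  fst snd : Term → Term
  fst x = app π₁ x
  snd x = app π₂ x

  id-β : ∀ x → app idT x ≃ x
  id-β x = β≃ (var 0) x

  ⨾-β : ∀ f g x → app (f ⨾ g) x ≃ app g (app f x)
  ⨾-β f g x = β≃ _ x ⊙ app≃ (≈⇒≃ (subst-single-↑ x g)) (app≃ (≈⇒≃ (subst-single-↑ x f)) refl≃)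

  subst-component : ∀ x h → subst (exts (single x)) (↑ (app (↑ h) (var 0))) ≈ ↑ (app h x)
  subst-component x h =
    ≈-trans (subst-exts-↑ (single x) (app (↑ h) (var 0)))
            (rename-resp-≈ suc (app≈ (subst-single-↑ x h) (≈-refl x)))

  tupleT-β : ∀ k ts x → app (tupleT k ts) x ≃ tuple k (λ i → app (ts i) x)
  tupleT-β k ts x =
    β≃ _ x
    ⊙ ≈⇒≃ (lam≈ (≈-trans (subst-apps _ (var 0) k _)
                         (apps-resp-≈ k (var≈ 0) (λ i → subst-component x (ts i)))))

  pairT-β : ∀ f g x → app (pairT f g) x ≃ ⟨ app f x , app g x ⟩
  pairT-β f g x = β≃ _ x ⊙ ≈⇒≃ (lam≈ (app≈ (app≈ (var≈ 0) (subst-component x f)) (subst-component x g)))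

  fst-pairT : ∀ f g x → fst (app (pairT f g) x) ≃ app f x
  fst-pairT f g x =
    app≃ refl≃ (pairT-β f g x) ⊙ proj-tuple 2 zero (λ { zero → app f x ; (suc zero) → app g x })

  snd-pairT : ∀ f g x → snd (app (pairT f g) x) ≃ app g x
  snd-pairT f g x =
    app≃ refl≃ (pairT-β f g x) ⊙ proj-tuple 2 (suc zero) (λ { zero → app f x ; (suc zero) → app g x })

  fst-⊗T : ∀ f g x → fst (app (f ⊗T g) x) ≃ app f (fst x)
  fst-⊗T f g x = fst-pairT _ _ x ⊙ ⨾-β π₁ f x

  snd-⊗T : ∀ f g x → snd (app (f ⊗T g) x) ≃ app g (snd x)
  snd-⊗T f g x = snd-pairT _ _ x ⊙ ⨾-β π₂ g x

  fst-assocT : ∀ x → fst (app assocT x) ≃ fst (fst x)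
  fst-assocT x = fst-pairT _ _ x ⊙ ⨾-β π₁ π₁ x

  fst-snd-assocT : ∀ x → fst (snd (app assocT x)) ≃ snd (fst x)
  fst-snd-assocT x = app≃ refl≃ (snd-pairT _ _ x) ⊙ fst-pairT _ _ x ⊙ ⨾-β π₁ π₂ x

  snd-snd-assocT : ∀ x → snd (snd (app assocT x)) ≃ snd x
  snd-snd-assocT x = app≃ refl≃ (snd-pairT _ _ x) ⊙ snd-pairT _ _ x

  evT-β : ∀ x → app evT x ≃ app (fst x) (snd x)
  evT-β x = β≃ _ x

  curryT-β : ∀ t x → app (curryT t) x ≃ lam (app (↑ t) ⟨ ↑ x , var 0 ⟩)
  curryT-β t x =
    β≃ _ x
    ⊙ lam≃ (app≃ (≈⇒≃ (≈-trans (subst-exts-↑ (single x) (↑ t)) (rename-resp-≈ suc (subst-single-↑ x t))))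
                 refl≃)

  ⨾-closed : ∀ {f g} → Closed f → Closed g → Closed (f ⨾ g)
  ⨾-closed f g = s-lam (s-app (↑-scoped g) (s-app (↑-scoped f) (s-var (s≤s z≤n))))

  pairT-closed : ∀ {f g} → Closed f → Closed g → Closed (pairT f g)
  pairT-closed f g =
    s-lam (s-lam (s-app (s-app (s-var (s≤s z≤n)) (↑-scoped (s-app (↑-scoped f) (s-var (s≤s z≤n)))))
                        (↑-scoped (s-app (↑-scoped g) (s-var (s≤s z≤n))))))

  π₁-closed : Closed π₁
  π₁-closed = proj-closed 2 zero

  π₂-closed : Closed π₂
  π₂-closed = proj-closed 2 (suc zero)

  ⊗T-closed : ∀ {f g} → Closed f → Closed g → Closed (f ⊗T g)
  ⊗T-closed f g = pairT-closed (⨾-closed π₁-closed f) (⨾-closed π₂-closed g)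

  idT-closed : Closed idT
  idT-closed = s-lam (s-var (s≤s z≤n))

  evT-closed : Closed evT
  evT-closed =
    s-lam (s-app (s-app (scoped-weaken π₁-closed z≤n) (s-var (s≤s z≤n)))
                 (s-app (scoped-weaken π₂-closed z≤n) (s-var (s≤s z≤n))))

  assocT-closed : Closed assocT
  assocT-closed =
    pairT-closed (⨾-closed π₁-closed π₁-closed) (pairT-closed (⨾-closed π₁-closed π₂-closed) π₂-closed)

  caseMs-closed : Closed caseMs
  caseMs-closed =
    s-lam (s-case (λ i → s-just (s-app (scoped-weaken (proj-closed n i) z≤n)
                                        (s-app (scoped-weaken π₁-closed z≤n) (s-var (s≤s z≤n)))))
                  (s-app (scoped-weaken π₂-closed z≤n) (s-var (s≤s z≤n))))

  caseOf : Term → Term → Term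
  caseOf a b = case (λ i → just (app (proj n i) a)) b

  caseMs-β : ∀ x → app caseMs x ≃ caseOf (fst x) (snd x)
  caseMs-β x = β≃ _ x ⊙ case≃ (λ i → just≃ (app≃ (≈⇒≃ (closed-subst _ (proj-closed n i))) refl≃)) refl≃

  caseOf-resp : ∀ {a a′ b b′} → Dⁿ a a′ → b ≃ b′ → caseOf a b ≃ caseOf a′ b′
  caseOf-resp as b = case≃ (λ i → just≃ (as i)) b

  caseOf-≃ : ∀ {a a′ b b′} → a ≃ a′ → b ≃ b′ → caseOf a b ≃ caseOf a′ b′
  caseOf-≃ a b = caseOf-resp (λ i → app≃ refl≃ a) b

  caseOf-lam : ∀ a b → caseOf a b ≃ lam (caseOf (↑ a) (app (↑ b) (var 0)))
  caseOf-lam a b =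
    case≃ (λ i → just≃ refl≃) (sym≃ (step (η b)))
    ⊙ step (case-lam _ _)
    ⊙ lam≃ (case≃ (λ i → just≃ (app≃ (≈⇒≃ (closed-rename suc (proj-closed n i))) refl≃)) refl≃)

  ≃-isPER : IsPER _≃_
  ≃-isPER = record { symm = sym≃ ; trans = trans≃ ; compat = λ p q → p ⊙ sym≃ q }

  idT-unfold : Mor _≃_ (_≃_ ⇒ _≃_) idT
  idT-unfold p q = app≃ (id-β _ ⊙ p ⊙ sym≃ (id-β _)) q

  idT-fold : Mor (_≃_ ⇒ _≃_) _≃_ idT
  idT-fold p = id-β _ ⊙ ≃-ext p ⊙ sym≃ (id-β _)

  idT⨾idT-β : ∀ x → app (idT ⨾ idT) x ≃ x
  idT⨾idT-β x = ⨾-β idT idT x ⊙ id-β _ ⊙ id-β x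

  case-mor : Mor (Dⁿ ⊗ _≃_) _≃_ caseMs
  case-mor h = caseMs-β _ ⊙ caseOf-resp (h zero) (h (suc zero)) ⊙ sym≃ (caseMs-β _)

  ≃-via : ∀ {f g x x′} (nf : Term → Term) → (∀ x → app f x ≃ nf x) → (∀ x → app g x ≃ nf x) →
          nf x ≃ nf x′ → app f x ≃ app g x′
  ≃-via nf f-nf g-nf nf-resp = f-nf _ ⊙ nf-resp ⊙ sym≃ (g-nf _)

  case-con-law : ∀ i → EqMor Dⁿ _≃_ ((unitorT ⨾ (idT ⊗T cT i)) ⨾ caseMs) (proj n i)
  case-con-law i h = ≃-via (app (proj n i))
    (λ x → ⨾-β _ _ x ⊙ app≃ refl≃ (⨾-β _ _ x) ⊙ caseMs-β _
           ⊙ caseOf-≃ (fst-⊗T _ _ _ ⊙ id-β _ ⊙ fst-pairT _ _ x ⊙ id-β x) (snd-⊗T _ _ _ ⊙ β≃ _ _)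
           ⊙ step (case-con _ i _ refl))
    (λ _ → refl≃)
    (h i)

  case-app-law : EqMor ((Dⁿ ⊗ _≃_) ⊗ _≃_) _≃_
    (((caseMs ⊗T idT) ⨾ (idT ⊗T idT)) ⨾ evT)
    (((assocT ⨾ (idT ⊗T (idT ⊗T idT))) ⨾ (idT ⊗T evT)) ⨾ caseMs)
  case-app-law h = ≃-via (λ x → caseOf (fst (fst x)) (app (snd (fst x)) (snd x)))
    (λ x → ⨾-β _ _ x ⊙ app≃ refl≃ (⨾-β _ _ x) ⊙ evT-β _
           ⊙ app≃ (fst-⊗T _ _ _ ⊙ id-β _ ⊙ fst-⊗T _ _ _ ⊙ caseMs-β _)
                  (snd-⊗T _ _ _ ⊙ id-β _ ⊙ snd-⊗T _ _ _ ⊙ id-β _)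
           ⊙ sym≃ (step (case-app _ _ _)))
    (λ x → ⨾-β _ _ x ⊙ app≃ refl≃ (⨾-β _ _ x ⊙ app≃ refl≃ (⨾-β _ _ x)) ⊙ caseMs-β _
           ⊙ caseOf-≃ (fst-⊗T _ _ _ ⊙ id-β _ ⊙ fst-⊗T _ _ _ ⊙ id-β _ ⊙ fst-assocT x)
                      (snd-⊗T _ _ _ ⊙ evT-β _
                       ⊙ app≃ (app≃ refl≃ (snd-⊗T _ _ _) ⊙ fst-⊗T _ _ _ ⊙ id-β _ ⊙ fst-snd-assocT x)
                              (app≃ refl≃ (snd-⊗T _ _ _) ⊙ snd-⊗T _ _ _ ⊙ id-β _ ⊙ snd-snd-assocT x)))
    (caseOf-resp (h zero zero) (app≃ (h zero (suc zero)) (h (suc zero))))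

  -- Both sides are compared before the η-expansion, where extensionality of D ⇒ D applies.
  case-lam-law : EqMor (Dⁿ ⊗ (_≃_ ⇒ _≃_)) _≃_
    ((idT ⊗T idT) ⨾ caseMs)
    (curryT ((assocT ⨾ (idT ⊗T evT)) ⨾ caseMs) ⨾ idT)
  case-lam-law h = ≃-via (λ x → caseOf (fst x) (snd x))
    (λ x → ⨾-β _ _ x ⊙ caseMs-β _ ⊙ caseOf-≃ (fst-⊗T _ _ _ ⊙ id-β _) (snd-⊗T _ _ _ ⊙ id-β _))
    (λ x → ⨾-β _ _ x ⊙ id-β _ ⊙ curryT-β _ x ⊙ lam≃ (uncurried x) ⊙ sym≃ (caseOf-lam (fst x) (snd x)))
    (caseOf-resp (h zero) (≃-ext (h (suc zero))))
    where
    S : Term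
    S = (assocT ⨾ (idT ⊗T evT)) ⨾ caseMs

    uncurried : ∀ x → app (↑ S) ⟨ ↑ x , var 0 ⟩ ≃ caseOf (fst (↑ x)) (app (snd (↑ x)) (var 0))
    uncurried x =
      app≃ (≈⇒≃ (closed-rename suc (⨾-closed (⨾-closed assocT-closed (⊗T-closed idT-closed evT-closed))
                                              caseMs-closed))) refl≃
      ⊙ ⨾-β _ _ w ⊙ app≃ refl≃ (⨾-β _ _ w) ⊙ caseMs-β _
      ⊙ caseOf-≃ (fst-⊗T _ _ _ ⊙ id-β _ ⊙ fst-assocT w ⊙ app≃ refl≃ (proj-tuple 2 zero ws))
                 (snd-⊗T _ _ _ ⊙ evT-β _
                  ⊙ app≃ (fst-snd-assocT w ⊙ app≃ refl≃ (proj-tuple 2 zero ws))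
                         (snd-snd-assocT w ⊙ proj-tuple 2 (suc zero) ws))
      where
      ws : Fin 2 → Term
      ws = λ { zero → ↑ x ; (suc zero) → var 0 }
      w : Term
      w = ⟨ ↑ x , var 0 ⟩

  case-case-law : EqMor ((Dⁿ ⊗ Dⁿ) ⊗ _≃_) _≃_
    ((tupleT n (λ i → (idT ⊗T proj n i) ⨾ caseMs) ⊗T idT) ⨾ caseMs)
    ((assocT ⨾ (idT ⊗T caseMs)) ⨾ caseMs)
  case-case-law h =
    ≃-via (λ x → case (λ i → just (caseOf (fst (fst x)) (app (proj n i) (snd (fst x))))) (snd x))
    (λ x → ⨾-β _ _ x ⊙ caseMs-β _
           ⊙ case≃ (λ i → just≃ (app≃ refl≃ (fst-⊗T _ _ _ ⊙ tupleT-β n _ _) ⊙ proj-tuple n i _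
                                 ⊙ ⨾-β _ _ _ ⊙ caseMs-β _
                                 ⊙ caseOf-≃ (fst-⊗T _ _ _ ⊙ id-β _) (snd-⊗T _ _ _)))
                   (snd-⊗T _ _ _ ⊙ id-β _))
    (λ x → ⨾-β _ _ x ⊙ app≃ refl≃ (⨾-β _ _ x) ⊙ caseMs-β _
           ⊙ caseOf-≃ (fst-⊗T _ _ _ ⊙ id-β _ ⊙ fst-assocT x)
                      (snd-⊗T _ _ _ ⊙ caseMs-β _ ⊙ caseOf-≃ (fst-snd-assocT x) (snd-snd-assocT x))
           ⊙ step (case-case _ _ _) ⊙ case≃ (λ i → just≃ refl≃) refl≃)
    (case≃ (λ i → just≃ (caseOf-resp (h zero zero) (h zero (suc zero) i))) (h (suc zero)))

case-fail-law : ∀ m → let open LC (suc m) in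
                EqMor ((_≃_ ^ suc m) ⊗ 𝟙) _≃_ ((idT ⊗T failMs m) ⨾ caseMs) (π₂ ⨾ failMs m)
case-fail-law m h = ≃-via (λ _ → case (λ _ → nothing) (con zero))
  (λ x → ⨾-β _ _ x ⊙ caseMs-β _ ⊙ case≃ (λ i → just≃ refl≃) (snd-⊗T _ _ _ ⊙ β≃ _ _)
         ⊙ step (case-case _ (λ _ → nothing) _) ⊙ case≃ (λ i → nothing≃) refl≃)
  (λ x → ⨾-β _ _ x ⊙ β≃ _ _)
  refl≃
  where
  open LC (suc m)
  open Syntax (suc m)
  open Model (suc m)

proposition5 : (m : ℕ) →
    LC.IsλCModel (suc m) (LC.Ds (suc m)) (LC.idT (suc m)) (LC.idT (suc m))
      (LC.cT (suc m)) (failMs m) (LC.caseMs (suc m))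
proposition5 m = record
  { D-PER    = ≃-isPER
  ; app-mor  = idT-unfold
  ; lam-mor  = idT-fold
  ; c-mor    = λ i _ → β≃ _ _ ⊙ sym≃ (β≃ _ _)
  ; fail-mor = λ _ → β≃ _ _ ⊙ sym≃ (β≃ _ _)
  ; case-mor = case-mor
  ; D1a      = λ p q → app≃ (idT⨾idT-β _) refl≃ ⊙ p q ⊙ app≃ (sym≃ (id-β _)) refl≃
  ; D1b      = λ p → idT⨾idT-β _ ⊙ p ⊙ sym≃ (id-β _)
  ; D2       = case-con-law
  ; D3       = case-app-law
  ; D4       = case-lam-law
  ; D5       = case-case-law
  ; D6       = case-fail-law m
  }
  where
  open LC (suc m)
  open Syntax (suc m)
  open Model (suc m)
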